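{- Suppose $1/n\ll\alpha$. Let $D$ be a digraph of order $n$ such that $\delta^0(D)\ge(\tfrac12+\alpha)n$. If $P$ is a rooted oriented path of order $3$, then $D$ contains a spanning $P$-connected subdigraph $H$ which is the union of $n-1$ $P$-diamonds and such that $\Delta^0(H)\le4/\alpha$.
   Context: $1/n\ll\alpha$ means: for every $\alpha>0$ the statement holds for all sufficiently large $n$. $\delta^0(D)$ is the minimum over vertices of $\min\{\deg^+,\deg^-\}$; $\Delta^0(H)$ is the maximum over vertices of $\max\{\deg^+,\deg^-\}$. $P$ is an oriented path on vertices $a,b,c$ (edges between $a,b$ and between $b,c$, each with some orientation), rooted at the endvertex $a$, with ancestral order $a\prec b\prec c$. A $P$-diamond is the digraph obtained from $P$ by replacing $b$ by two vertices $v,v'$, each joined to (the copies $u$ of $a$ and $w$ of $c$) with the same orientations as $b$ was to $a$ and $c$; it is denoted $(u,\{v,v'\},w)$ and has prefix $u$, middle $\{v,v'\}$, suffix $w$; its branches are the paths $uvw$ and $uv'w$. A $P$-diamond path is a sequence of $P$-diamonds $(u_i,\{v_i,v'_i\},w_i)_{i=0}^t$ with $v_i=v'_{i-1}$ for each $i\in[t]$; it connects $v_0$ and $v'_t$. A digraph is $P$-connected if for each pair of vertices $u,v$ it contains a $P$-diamond path connecting $u$ and $v$. -}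

module Defs where

open import Data.Nat using (ℕ; zero; suc; _+_)
open import Data.Bool using (Bool; true; false)
open import Data.Fin using (Fin; zero; suc)
open import Data.Product using (Σ; ∃; _×_; _,_)
open import Data.Sum using (_⊎_)
open import Relation.Binary.PropositionalEquality using (_≡_; _≢_)

-- A digraph on the vertex set Fin n, given by its (decidable) arc relation:
-- adj i j ≡ true  means there is an arc i → j.
Digraph : ℕ → Set
Digraph n = Fin n → Fin n → Bool

Loopless : ∀ {n} → Digraph n → Set
Loopless {n} G = (i : Fin n) → G i i ≡ false

count : ∀ {n} → (Fin n → Bool) → ℕ
count {zero}  f = 0
count {suc n} f with f zero
... | true  = suc (count (λ x → f (suc x)))
... | false = count (λ x → f (suc x))

outdeg indeg : ∀ {n} → Digraph n → Fin n → ℕ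
outdeg G i = count (λ j → G i j)
indeg  G i = count (λ j → G j i)

_⊆ᴰ_ : ∀ {n} → Digraph n → Digraph n → Set
_⊆ᴰ_ {n} H G = (i j : Fin n) → H i j ≡ true → G i j ≡ true

-- An oriented path P = a b c of order 3, rooted at a, is determined by the
-- orientations of its two edges:
--   o₁ = true : a → b,   o₁ = false : b → a
--   o₂ = true : b → c,   o₂ = false : c → b
-- All four rooted oriented paths of order 3 arise this way.
record Path3 : Set where
  constructor path3
  field
    o₁ : Bool
    o₂ : Bool

OArc : ∀ {n} → Fin n → Fin n → Bool → Fin n → Fin n → Set
OArc x y true  i j = (i ≡ x) × (j ≡ y)
OArc x y false i j = (i ≡ y) × (j ≡ x)

-- A (labelled) P-diamond (u, {v, v'}, w): prefix u, middle {v, v'}, suffix w.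
record Diamond (n : ℕ) : Set where
  constructor diamond
  field
    u  : Fin n
    v  : Fin n
    v' : Fin n
    w  : Fin n

DiamondArc : ∀ {n} → Path3 → Diamond n → Fin n → Fin n → Set
DiamondArc (path3 o₁ o₂) (diamond u v v' w) i j =
  OArc u v o₁ i j ⊎ OArc u v' o₁ i j ⊎ OArc v w o₂ i j ⊎ OArc v' w o₂ i j

Distinct4 : ∀ {n} → Diamond n → Set
Distinct4 (diamond u v v' w) =
  (u ≢ v) × (u ≢ v') × (u ≢ w) × (v ≢ v') × (v ≢ w) × (v' ≢ w)

IsDiamondIn : ∀ {n} → Path3 → Digraph n → Diamond n → Set
IsDiamondIn {n} P G d =
  Distinct4 d × ((i j : Fin n) → DiamondArc P d i j → G i j ≡ true)

-- A P-diamond path (u_i, {v_i, v'_i}, w_i)_{i=0}^t in G: diamonds indexed by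
-- Fin (suc t), each a P-diamond in G, with v_i = v'_{i-1} for i ∈ [t].
record DiamondPath {n} (P : Path3) (G : Digraph n) : Set where
  field
    t      : ℕ
    dia    : Fin (suc t) → Diamond n
    isDia  : (i : Fin (suc t)) → IsDiamondIn P G (dia i)
    linked : (i : Fin t) →
             Diamond.v (dia (Data.Fin.suc i)) ≡ Diamond.v' (dia (Data.Fin.inject₁ i))

Connects : ∀ {n} {P : Path3} {G : Digraph n} → DiamondPath P G → Fin n → Fin n → Set
Connects p x y =
  (Diamond.v (DiamondPath.dia p zero) ≡ x) ×
  (Diamond.v' (DiamondPath.dia p (Data.Fin.fromℕ (DiamondPath.t p))) ≡ y)

PConnected : ∀ {n} → Path3 → Digraph n → Set
PConnected {n} P G =
  (x y : Fin n) → x ≢ y → Σ (DiamondPath P G) (λ p → Connects p x y)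

IsUnionOf : ∀ {n m} → Path3 → Digraph n → (Fin m → Diamond n) → Set
IsUnionOf {n} {m} P H ds =
  (i j : Fin n) → (H i j ≡ true → ∃ λ (k : Fin m) → DiamondArc P (ds k) i j)
                × ((∃ λ (k : Fin m) → DiamondArc P (ds k) i j) → H i j ≡ true)

module Submission where

-- Number the vertices 0, …, n − 1. For each k < n − 1 choose a vertex u_k joined to both k and k + 1
-- as the root a of P is joined to b, and a vertex w_k ≠ u_k joined to both as c is to b; then
-- (u_k, {k, k+1}, w_k) is a P-diamond, and consecutive diamonds share a middle vertex, so walking
-- along them (with the middles swapped when walking downwards) connects any two vertices.
-- Two vertices have at least 2αn common in-neighbours (and out-neighbours) by the degree condition.
-- The choices are greedy and avoid the vertices already used Λ = ⌊1/α⌋ times in the same role;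
-- after k < n choices fewer than n/Λ vertices are excluded, which for large n leaves two of the 2αn
-- common neighbours, and every vertex has in- and out-degree at most 4Λ ≤ 4/α in the union of the diamonds.

import Data.Nat as ℕ
open import Data.Nat using (ℕ; suc)
open import Data.Fin using (Fin)
open import Data.Bool using (Bool)
open import Data.Product using (_×_)
open import Defs

module Counting where

  open import Data.Nat using (ℕ; zero; suc; _+_; _*_; _≤_; z≤n; s≤s; _≤?_)
  open import Data.Nat.Properties hiding (_≟_; suc-injective)
  open import Data.Bool using (Bool; true; false; _∧_; _∨_; not)
  open import Data.Fin using (Fin; zero; suc; toℕ; inject₁; fromℕ)
  open import Data.Bool.Properties using () renaming (_≟_ to _≟ᵇ_)
  open import Data.Fin.Properties using (any?; _≟_; suc-injective; toℕ-inject₁; toℕ-fromℕ)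
  open import Data.Product using (_×_; _,_)
  open import Function using (_∘_)
  open import Function.Definitions using (Injective)
  open import Relation.Nullary using (Dec; yes; no; does; ¬_; contradiction)
  open import Relation.Nullary.Decidable using (dec-true)
  open import Relation.Binary.PropositionalEquality
  open import Algebra.Properties.Semiring.Sum +-*-semiring
    using (sum; ∑-distrib-+; *-distribˡ-sum; sum-init-last; sum-cong-≗)

  iverson : Bool → ℕ
  iverson true  = 1
  iverson false = 0

  count≡sum : ∀ {n} (f : Fin n → Bool) → count f ≡ sum (λ x → iverson (f x))
  count≡sum {zero}  f = refl
  count≡sum {suc n} f with f zero
  ... | true  = cong suc (count≡sum (λ x → f (suc x)))
  ... | false = count≡sum (λ x → f (suc x))

  sum-mono-≤ : ∀ {n} {f g : Fin n → ℕ} → (∀ x → f x ≤ g x) → sum f ≤ sum g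
  sum-mono-≤ {zero}  f≤g = z≤n
  sum-mono-≤ {suc n} f≤g = +-mono-≤ (f≤g zero) (sum-mono-≤ (λ x → f≤g (suc x)))

  count-lift : ∀ {n} (f g h k : Fin n → Bool) →
               (∀ x → iverson (f x) + iverson (g x) ≤ iverson (h x) + iverson (k x)) →
               count f + count g ≤ count h + count k
  count-lift f g h k pointwise = begin
    count f + count g                                     ≡⟨ cong₂ _+_ (count≡sum f) (count≡sum g) ⟩
    sum (λ x → iverson (f x)) + sum (λ x → iverson (g x)) ≡⟨ sym (∑-distrib-+ (iverson ∘ f) (iverson ∘ g)) ⟩
    sum (λ x → iverson (f x) + iverson (g x))             ≤⟨ sum-mono-≤ pointwise ⟩
    sum (λ x → iverson (h x) + iverson (k x))             ≡⟨ ∑-distrib-+ (iverson ∘ h) (iverson ∘ k) ⟩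
    sum (λ x → iverson (h x)) + sum (λ x → iverson (k x)) ≡⟨ sym (cong₂ _+_ (count≡sum h) (count≡sum k)) ⟩
    count h + count k                                     ∎
    where open ≤-Reasoning

  count-false : ∀ n → count {n} (λ _ → false) ≡ 0
  count-false zero    = refl
  count-false (suc n) = count-false n

  count-true : ∀ n → count {n} (λ _ → true) ≡ n
  count-true zero    = refl
  count-true (suc n) = cong suc (count-true n)

  count-lift₁ : ∀ {n} (f h k : Fin n → Bool) →
                (∀ x → iverson (f x) ≤ iverson (h x) + iverson (k x)) → count f ≤ count h + count k
  count-lift₁ {n} f h k pointwise = begin
    count f                           ≡⟨ sym (+-identityʳ (count f)) ⟩
    count f + 0                       ≡⟨ cong (count f +_) (sym (count-false n)) ⟩
    count f + count {n} (λ _ → false)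
      ≤⟨ count-lift f _ h k (λ x → ≤-trans (≤-reflexive (+-identityʳ _)) (pointwise x)) ⟩
    count h + count k                 ∎
    where open ≤-Reasoning

  count-mono : ∀ {n} {f g : Fin n → Bool} → (∀ x → f x ≡ true → g x ≡ true) → count f ≤ count g
  count-mono {n} {f} {g} f⇒g = begin
    count f                           ≤⟨ count-lift₁ f g (λ _ → false) pointwise ⟩
    count g + count {n} (λ _ → false) ≡⟨ cong (count g +_) (count-false n) ⟩
    count g + 0                       ≡⟨ +-identityʳ (count g) ⟩
    count g                           ∎
    where
    open ≤-Reasoning
    pointwise : ∀ x → iverson (f x) ≤ iverson (g x) + 0
    pointwise x with f x | f⇒g x
    ... | false | _     = z≤n
    ... | true  | fx⇒gx rewrite fx⇒gx refl = ≤-refl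

  count≤n : ∀ {n} (f : Fin n → Bool) → count f ≤ n
  count≤n {n} f = subst (count f ≤_) (count-true n) (count-mono {n} {f} {λ _ → true} (λ _ _ → refl))

  count-∨ : ∀ {n} (f g : Fin n → Bool) → count (λ x → f x ∨ g x) ≤ count f + count g
  count-∨ f g = count-lift₁ _ f g (λ x → pointwise (f x) (g x))
    where
    pointwise : ∀ a b → iverson (a ∨ b) ≤ iverson a + iverson b
    pointwise true  true  = s≤s z≤n
    pointwise true  false = ≤-refl
    pointwise false b     = ≤-refl

  count-split : ∀ {n} (f g : Fin n → Bool) → count f ≤ count (λ x → f x ∧ not (g x)) + count g
  count-split f g = count-lift₁ f _ g (λ x → pointwise (f x) (g x))
    where
    pointwise : ∀ a b → iverson a ≤ iverson (a ∧ not b) + iverson b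
    pointwise true  true  = ≤-refl
    pointwise true  false = ≤-refl
    pointwise false b     = z≤n

  count-∧ : ∀ {n} (f g : Fin n → Bool) → count f + count g ≤ count (λ x → f x ∧ g x) + n
  count-∧ {n} f g = subst (count f + count g ≤_) (cong (count (λ x → f x ∧ g x) +_) (count-true n))
    (count-lift f g _ (λ _ → true) (λ x → pointwise (f x) (g x)))
    where
    pointwise : ∀ a b → iverson a + iverson b ≤ iverson (a ∧ b) + 1
    pointwise true  true  = ≤-refl
    pointwise true  false = ≤-refl
    pointwise false true  = ≤-refl
    pointwise false false = z≤n

  does-sound : ∀ {a} {A : Set a} (a? : Dec A) → does a? ≡ true → A
  does-sound (yes a) _ = a

  not-does-sound : ∀ {a} {A : Set a} (a? : Dec A) → not (does a?) ≡ true → ¬ A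
  not-does-sound (no ¬a) _ = ¬a

  ∧-true : ∀ {a b} → a ∧ b ≡ true → a ≡ true × b ≡ true
  ∧-true {true} b≡true = refl , b≡true

  multiplicity : ∀ {m n} → (Fin m → Fin n) → Fin n → ℕ
  multiplicity f x = count (λ k → does (f k ≟ x))

  multiplicity-injective : ∀ {m n} (f : Fin m → Fin n) → Injective _≡_ _≡_ f →
                           ∀ x → multiplicity f x ≤ 1
  multiplicity-injective {zero}  f f-inj x = z≤n
  multiplicity-injective {suc m} f f-inj x with f zero ≟ x
  ... | yes refl = s≤s (subst (count {m} (λ k → does (f (suc k) ≟ f zero)) ≤_) (count-false m)
                               (count-mono {m} {g = λ _ → false} others-miss))
    where
    others-miss : ∀ k → does (f (suc k) ≟ f zero) ≡ true → false ≡ true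
    others-miss k hit with f-inj (does-sound (f (suc k) ≟ f zero) hit)
    ... | ()
  ... | no _ = multiplicity-injective (λ k → f (suc k)) (λ eq → suc-injective (f-inj eq)) x

  count-≟ : ∀ {n} (x : Fin n) → count (λ y → does (x ≟ y)) ≤ 1
  count-≟ {n} x = ≤-trans (count-mono {n} {g = λ y → does (y ≟ x)} flip)
                          (multiplicity-injective (λ y → y) (λ eq → eq) x)
    where
    flip : ∀ y → does (x ≟ y) ≡ true → does (y ≟ x) ≡ true
    flip y x≟y = dec-true (y ≟ x) (sym (does-sound (x ≟ y) x≟y))

  count-saturated : ∀ {n} c (ℓ : Fin n → ℕ) → c * count (λ x → does (c ≤? ℓ x)) ≤ sum ℓ
  count-saturated c ℓ = begin
    c * count (λ x → does (c ≤? ℓ x))              ≡⟨ cong (c *_) (count≡sum (λ x → does (c ≤? ℓ x))) ⟩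
    c * sum (λ x → iverson (does (c ≤? ℓ x)))      ≡⟨ *-distribˡ-sum c (λ x → iverson (does (c ≤? ℓ x))) ⟩
    sum (λ x → c * iverson (does (c ≤? ℓ x)))      ≤⟨ sum-mono-≤ pointwise ⟩
    sum ℓ                                          ∎
    where
    open ≤-Reasoning
    pointwise : ∀ x → c * iverson (does (c ≤? ℓ x)) ≤ ℓ x
    pointwise x = bound (c ≤? ℓ x)
      where
      bound : (c≤?ℓx : Dec (c ≤ ℓ x)) → c * iverson (does c≤?ℓx) ≤ ℓ x
      bound (yes c≤ℓx) = ≤-trans (≤-reflexive (*-identityʳ c)) c≤ℓx
      bound (no  _)    = ≤-trans (≤-reflexive (*-zeroʳ c)) z≤n

  count-any : ∀ {m n} {P : Fin m → Fin n → Set} (P? : ∀ k j → Dec (P k j)) →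
              count (λ j → does (any? (λ k → P? k j))) ≤ sum (λ k → count (λ j → does (P? k j)))
  count-any {zero}  {n} P? = ≤-reflexive (count-false n)
  count-any {suc m}     P? = ≤-trans (count-∨ (λ j → does (P? zero j)) _)
                                      (+-monoʳ-≤ _ (count-any (λ k → P? (suc k))))

  choose : ∀ {n} → (Fin (suc n) → Bool) → Fin (suc n)
  choose f with any? (λ x → f x ≟ᵇ true)
  ... | yes (x , _) = x
  ... | no _        = zero

  choose-true : ∀ {n} (f : Fin (suc n) → Bool) → 1 ≤ count f → f (choose f) ≡ true
  choose-true {n} f nonempty with any? (λ x → f x ≟ᵇ true)
  ... | yes (_ , fx) = fx
  ... | no none      = contradiction (≤-trans nonempty (≤-trans (count-mono {f = f} {g = λ _ → false} none-true)
                                                               (≤-reflexive (count-false (suc n))))) λ ()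
    where
    none-true : ∀ x → f x ≡ true → false ≡ true
    none-true x fx = contradiction (x , fx) none

  count-range-suc : ∀ k (h : ℕ → Bool) →
                    count {suc k} (λ j → h (toℕ j)) ≡ count {k} (λ j → h (toℕ j)) + iverson (h k)
  count-range-suc k h = begin
    count {suc k} (λ j → h (toℕ j))                 ≡⟨ count≡sum {suc k} (λ j → h (toℕ j)) ⟩
    sum {suc k} (λ j → iverson (h (toℕ j)))         ≡⟨ sum-init-last (λ j → iverson (h (toℕ j))) ⟩
    sum {k} (λ j → iverson (h (toℕ (inject₁ j)))) + iverson (h (toℕ (fromℕ k)))
      ≡⟨ cong₂ _+_ (sum-cong-≗ {k} (λ j → cong (λ i → iverson (h i)) (toℕ-inject₁ j)))
                   (cong (λ i → iverson (h i)) (toℕ-fromℕ k)) ⟩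
    sum {k} (λ j → iverson (h (toℕ j))) + iverson (h k)
      ≡⟨ sym (cong (_+ iverson (h k)) (count≡sum {k} (λ j → h (toℕ j)))) ⟩
    count {k} (λ j → h (toℕ j)) + iverson (h k)     ∎
    where open ≡-Reasoning

module Greedy {n : ℕ} (Λ : ℕ) (candidate : ℕ → Fin (suc n) → Bool) where

  open Counting
  open import Data.Nat using (zero; suc; _+_; _*_; _≤_; _<_; z≤n; _≤?_)
  open import Data.Nat.Properties hiding (_≟_)
  open import Data.Bool using (true; _∧_; not)
  open import Data.Fin using (toℕ)
  open import Data.Fin.Properties using (_≟_)
  open import Data.Product using (_×_; _,_; proj₁; proj₂)
  open import Relation.Nullary using (yes; no; does)
  open import Relation.Binary.PropositionalEquality
  open import Algebra.Properties.Semiring.Sum +-*-semiring using (sum; ∑-distrib-+; sum-replicate-zero)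

  Unsaturated : (Fin (suc n) → ℕ) → Fin (suc n) → Bool
  Unsaturated load x = not (does (Λ ≤? load x))

  mutual
    choice : ℕ → Fin (suc n)
    choice k = choose (λ x → candidate k x ∧ Unsaturated (load k) x)

    load : ℕ → Fin (suc n) → ℕ
    load zero    x = 0
    load (suc k) x = iverson (does (choice k ≟ x)) + load k x

  Balanced : ℕ → Set
  Balanced k = (∀ x → load k x ≤ Λ) × (sum (load k) ≤ k)

  -- Once Balanced k holds, the h saturated vertices satisfy Λ h ≤ k; Plenty k asks for more candidates than that.
  Plenty : ℕ → Set
  Plenty k = ∀ h → Λ * h ≤ k → h + 1 ≤ count (candidate k)

  choice-good : ∀ k → Plenty k → Balanced k → candidate k (choice k) ∧ Unsaturated (load k) (choice k) ≡ true
  choice-good k plenty (_ , total) =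
    choose-true (λ x → candidate k x ∧ Unsaturated (load k) x) (+-cancelˡ-≤ saturated 1 _ (begin
    saturated + 1                                  ≤⟨ plenty saturated (≤-trans (count-saturated Λ (load k)) total) ⟩
    count (candidate k)                            ≤⟨ count-split (candidate k) (λ x → does (Λ ≤? load k x)) ⟩
    count (λ x → candidate k x ∧ Unsaturated (load k) x) + saturated ≡⟨ +-comm _ saturated ⟩
    saturated + count (λ x → candidate k x ∧ Unsaturated (load k) x) ∎))
    where
    open ≤-Reasoning
    saturated = count (λ x → does (Λ ≤? load k x))

  balanced-step : ∀ k → Balanced k → load k (choice k) < Λ → Balanced (suc k)
  balanced-step k (bounded , total) room = bumped , total+1
    where
    bumped : ∀ x → load (suc k) x ≤ Λ
    bumped x with choice k ≟ x
    ... | yes refl = room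
    ... | no  _    = bounded x
    total+1 : sum (load (suc k)) ≤ suc k
    total+1 = begin
      sum (λ x → iverson (does (choice k ≟ x)) + load k x)
        ≡⟨ ∑-distrib-+ (λ x → iverson (does (choice k ≟ x))) (load k) ⟩
      sum (λ x → iverson (does (choice k ≟ x))) + sum (load k)
        ≡⟨ cong (_+ sum (load k)) (sym (count≡sum (λ x → does (choice k ≟ x)))) ⟩
      count (λ x → does (choice k ≟ x)) + sum (load k)
        ≤⟨ +-mono-≤ (count-≟ (choice k)) total ⟩
      suc k ∎
      where open ≤-Reasoning

  balanced : ∀ k → (∀ j → j < k → Plenty j) → Balanced k
  balanced zero    _      = (λ _ → z≤n) , ≤-reflexive (sum-replicate-zero (suc n))
  balanced (suc k) plenty = balanced-step k (balanced k plenty<k)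
    (≰⇒> (not-does-sound (Λ ≤? load k (choice k)) (proj₂ (∧-true good))))
    where
    plenty<k : ∀ j → j < k → Plenty j
    plenty<k j j<k = plenty j (m<n⇒m<1+n j<k)
    good : candidate k (choice k) ∧ Unsaturated (load k) (choice k) ≡ true
    good = choice-good k (plenty k ≤-refl) (balanced k plenty<k)

  load≡multiplicity : ∀ k x → multiplicity (λ (j : Fin k) → choice (toℕ j)) x ≡ load k x
  load≡multiplicity zero    x = refl
  load≡multiplicity (suc k) x = begin
    count {suc k} (λ j → does (choice (toℕ j) ≟ x))
      ≡⟨ count-range-suc k (λ i → does (choice i ≟ x)) ⟩
    count {k} (λ j → does (choice (toℕ j) ≟ x)) + iverson (does (choice k ≟ x))
      ≡⟨ cong (_+ iverson (does (choice k ≟ x))) (load≡multiplicity k x) ⟩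
    load k x + iverson (does (choice k ≟ x))
      ≡⟨ +-comm (load k x) _ ⟩
    load (suc k) x ∎
    where open ≡-Reasoning

  module _ (m : ℕ) (plenty : ∀ k → k < m → Plenty k) where

    choice-candidate : ∀ k → k < m → candidate k (choice k) ≡ true
    choice-candidate k k<m =
      proj₁ (∧-true (choice-good k (plenty k k<m) (balanced k λ j j<k → plenty j (<-trans j<k k<m))))

    choice-multiplicity : ∀ x → multiplicity (λ (j : Fin m) → choice (toℕ j)) x ≤ Λ
    choice-multiplicity x = subst (_≤ Λ) (sym (load≡multiplicity m x)) (proj₁ (balanced m plenty) x)

module Diamonds where

  open Counting
  open import Data.Nat using (ℕ; suc; _+_; _≤_; _<_; z≤n; s≤s⁻¹)
  open import Data.Nat.Properties using (≤-trans; ≤-reflexive; +-mono-≤; module ≤-Reasoning)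
  open import Data.Bool using (Bool; true; false; not)
  open import Data.Fin using (Fin; toℕ)
  open import Data.Fin.Properties using (any?; _≟_; toℕ<n; toℕ-inject₁; toℕ-fromℕ)
  open import Data.Product using (Σ; _×_; _,_; proj₁; proj₂)
  open import Data.Sum using (inj₁; inj₂) renaming (map to ⊎-map)
  open import Function using (_∘_)
  open import Relation.Nullary using (Dec; yes; no; does)
  open import Relation.Nullary.Decidable using (_×-dec_; _⊎-dec_; dec-true)
  open import Relation.Binary.PropositionalEquality
  open import Algebra.Properties.Semiring.Sum Data.Nat.Properties.+-*-semiring using (sum; ∑-distrib-+)

  OArc? : ∀ {n} (a b : Fin n) o i j → Dec (OArc a b o i j)
  OArc? a b true  i j = (i ≟ a) ×-dec (j ≟ b)
  OArc? a b false i j = (i ≟ b) ×-dec (j ≟ a)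

  DiamondArc? : ∀ {n} P (d : Diamond n) i j → Dec (DiamondArc P d i j)
  DiamondArc? (path3 o₁ o₂) (diamond u v v' w) i j =
    OArc? u v o₁ i j ⊎-dec OArc? u v' o₁ i j ⊎-dec OArc? v w o₂ i j ⊎-dec OArc? v' w o₂ i j

  ⋃ : ∀ {m n} → Path3 → (Fin m → Diamond n) → Digraph n
  ⋃ P ds i j = does (any? (λ k → DiamondArc? P (ds k) i j))

  ⋃-isUnionOf : ∀ {m n} P (ds : Fin m → Diamond n) → IsUnionOf P (⋃ P ds) ds
  ⋃-isUnionOf P ds i j = does-sound (any? _) , dec-true (any? _)

  ⋃-⊆ᴰ : ∀ {m n} P (ds : Fin m → Diamond n) (G : Digraph n) →
         (∀ k → IsDiamondIn P G (ds k)) → ⋃ P ds ⊆ᴰ G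
  ⋃-⊆ᴰ P ds G isDiamond i j ij∈⋃ with proj₁ (⋃-isUnionOf P ds i j) ij∈⋃
  ... | k , arc = proj₂ (isDiamond k) i j arc

  ⋃-contains : ∀ {m n} P (ds : Fin m → Diamond n) k → Distinct4 (ds k) → IsDiamondIn P (⋃ P ds) (ds k)
  ⋃-contains P ds k distinct = distinct , λ i j arc → proj₂ (⋃-isUnionOf P ds i j) (k , arc)

  swapMiddle : ∀ {n} → Diamond n → Diamond n
  swapMiddle (diamond u v v' w) = diamond u v' v w

  swapMiddle-isDiamondIn : ∀ {n} P (G : Digraph n) d → IsDiamondIn P G d → IsDiamondIn P G (swapMiddle d)
  swapMiddle-isDiamondIn (path3 o₁ o₂) G (diamond u v v' w) ((u≢v , u≢v' , u≢w , v≢v' , v≢w , v'≢w) , arcs) =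
    (u≢v' , u≢v , u≢w , v≢v' ∘ sym , v'≢w , v≢w) , λ i j → arcs i j ∘ swap-arc
    where
    swap-arc : ∀ {i j} → DiamondArc (path3 o₁ o₂) (diamond u v' v w) i j →
                         DiamondArc (path3 o₁ o₂) (diamond u v v' w) i j
    swap-arc (inj₁ a)               = inj₂ (inj₁ a)
    swap-arc (inj₂ (inj₁ a))        = inj₁ a
    swap-arc (inj₂ (inj₂ (inj₁ a))) = inj₂ (inj₂ (inj₂ a))
    swap-arc (inj₂ (inj₂ (inj₂ a))) = inj₂ (inj₂ (inj₁ a))

  tail : ∀ {n} → Bool → Fin n → Fin n → Fin n
  tail true  a b = a
  tail false a b = b

  count-OArc : ∀ {n} (a b : Fin n) o x → count (λ j → does (OArc? a b o x j)) ≤ iverson (does (tail o a b ≟ x))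
  count-OArc {n} a b true x with x ≟ a
  ... | yes refl rewrite dec-true (x ≟ x) refl = multiplicity-injective (λ j → j) (λ eq → eq) b
  ... | no  _    = ≤-trans (≤-reflexive (count-false n)) z≤n
  count-OArc {n} a b false x with x ≟ b
  ... | yes refl rewrite dec-true (x ≟ x) refl = multiplicity-injective (λ j → j) (λ eq → eq) a
  ... | no  _    = ≤-trans (≤-reflexive (count-false n)) z≤n

  count-DiamondArc : ∀ {n} o₁ o₂ (d : Diamond n) x →
    let open Diamond d in
    count (λ j → does (DiamondArc? (path3 o₁ o₂) d x j)) ≤
      iverson (does (tail o₁ u v ≟ x)) + (iverson (does (tail o₁ u v' ≟ x))
        + (iverson (does (tail o₂ v w ≟ x)) + iverson (does (tail o₂ v' w ≟ x))))
  count-DiamondArc {n} o₁ o₂ (diamond u v v' w) x =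
    ≤-trans (count-∨ {n} _ _) (+-mono-≤ (count-OArc u v o₁ x)
   (≤-trans (count-∨ {n} _ _) (+-mono-≤ (count-OArc u v' o₁ x)
   (≤-trans (count-∨ {n} _ _) (+-mono-≤ (count-OArc v w o₂ x) (count-OArc v' w o₂ x))))))

  EveryRoleAtMost : ∀ {m n} → ℕ → (Fin m → Diamond n) → Set
  EveryRoleAtMost Λ ds = ∀ x →
    (multiplicity (Diamond.u ∘ ds) x ≤ Λ) × (multiplicity (Diamond.v ∘ ds) x ≤ Λ) ×
    (multiplicity (Diamond.v' ∘ ds) x ≤ Λ) × (multiplicity (Diamond.w ∘ ds) x ≤ Λ)

  tail-multiplicity : ∀ {m n} o (a b : Fin m → Fin n) {Λ} x →
    multiplicity a x ≤ Λ → multiplicity b x ≤ Λ → multiplicity (λ k → tail o (a k) (b k)) x ≤ Λ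
  tail-multiplicity true  a b x a≤Λ b≤Λ = a≤Λ
  tail-multiplicity false a b x a≤Λ b≤Λ = b≤Λ

  ⋃-outdeg : ∀ {m n} o₁ o₂ (ds : Fin m → Diamond n) Λ → EveryRoleAtMost Λ ds →
             ∀ x → outdeg (⋃ (path3 o₁ o₂) ds) x ≤ Λ + (Λ + (Λ + Λ))
  ⋃-outdeg {m} o₁ o₂ ds Λ bounded x = begin
    outdeg (⋃ (path3 o₁ o₂) ds) x
      ≤⟨ count-any (λ k j → DiamondArc? (path3 o₁ o₂) (ds k) x j) ⟩
    sum (λ k → count (λ j → does (DiamondArc? (path3 o₁ o₂) (ds k) x j)))
      ≤⟨ sum-mono-≤ (λ k → count-DiamondArc o₁ o₂ (ds k) x) ⟩
    sum (λ k → occurs (tail o₁ (u k) (v k)) + (occurs (tail o₁ (u k) (v' k))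
                + (occurs (tail o₂ (v k) (w k)) + occurs (tail o₂ (v' k) (w k)))))
      ≤⟨ sum-+-≤ (role-sum o₁ u v u≤Λ v≤Λ) (sum-+-≤ (role-sum o₁ u v' u≤Λ v'≤Λ)
          (sum-+-≤ (role-sum o₂ v w v≤Λ w≤Λ) (role-sum o₂ v' w v'≤Λ w≤Λ))) ⟩
    Λ + (Λ + (Λ + Λ)) ∎
    where
    open ≤-Reasoning
    u v v' w : Fin m → Fin _
    u  = Diamond.u ∘ ds
    v  = Diamond.v ∘ ds
    v' = Diamond.v' ∘ ds
    w  = Diamond.w ∘ ds
    occurs : Fin _ → ℕ
    occurs y = iverson (does (y ≟ x))
    u≤Λ = proj₁ (bounded x)
    v≤Λ = proj₁ (proj₂ (bounded x))
    v'≤Λ = proj₁ (proj₂ (proj₂ (bounded x)))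
    w≤Λ = proj₂ (proj₂ (proj₂ (bounded x)))
    role-sum : ∀ o (a b : Fin m → Fin _) → multiplicity a x ≤ Λ → multiplicity b x ≤ Λ →
               sum (λ k → occurs (tail o (a k) (b k))) ≤ Λ
    role-sum o a b a≤Λ b≤Λ = subst (_≤ Λ) (count≡sum (λ k → does (tail o (a k) (b k) ≟ x)))
                                   (tail-multiplicity o a b x a≤Λ b≤Λ)
    sum-+-≤ : ∀ {f g : Fin m → ℕ} {a b} → sum f ≤ a → sum g ≤ b → sum (λ k → f k + g k) ≤ a + b
    sum-+-≤ {f} {g} f≤a g≤b = subst (_≤ _) (sym (∑-distrib-+ f g)) (+-mono-≤ f≤a g≤b)

  reverse : Path3 → Path3
  reverse (path3 o₁ o₂) = path3 (not o₁) (not o₂)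

  OArc-reverse : ∀ {n} (a b : Fin n) o {i j} → OArc a b o i j → OArc a b (not o) j i
  OArc-reverse a b true  (i≡a , j≡b) = j≡b , i≡a
  OArc-reverse a b false (i≡b , j≡a) = j≡a , i≡b

  DiamondArc-reverse : ∀ {n} P (d : Diamond n) {i j} → DiamondArc P d i j → DiamondArc (reverse P) d j i
  DiamondArc-reverse (path3 o₁ o₂) (diamond u v v' w) =
    ⊎-map (OArc-reverse u v o₁) (⊎-map (OArc-reverse u v' o₁) (⊎-map (OArc-reverse v w o₂) (OArc-reverse v' w o₂)))

  ⋃-indeg : ∀ {m n} o₁ o₂ (ds : Fin m → Diamond n) Λ → EveryRoleAtMost Λ ds →
            ∀ x → indeg (⋃ (path3 o₁ o₂) ds) x ≤ Λ + (Λ + (Λ + Λ))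
  ⋃-indeg {n = n} o₁ o₂ ds Λ bounded x =
    ≤-trans (count-mono {n} {λ i → ⋃ P ds i x} {λ i → ⋃ (reverse P) ds x i} reversed)
            (⋃-outdeg (not o₁) (not o₂) ds Λ bounded x)
    where
    P = path3 o₁ o₂
    reversed : ∀ i → ⋃ P ds i x ≡ true → ⋃ (reverse P) ds x i ≡ true
    reversed i ix∈⋃ with proj₁ (⋃-isUnionOf P ds i x) ix∈⋃
    ... | k , arc = proj₂ (⋃-isUnionOf (reverse P) ds x i) (k , DiamondArc-reverse P (ds k) arc)

  diamondPath : ∀ {n} P (G : Digraph n) (g : ℕ → Diamond n) t {x y} →
    (∀ i → i ≤ t → IsDiamondIn P G (g i)) →
    (∀ i → i < t → Diamond.v (g (suc i)) ≡ Diamond.v' (g i)) →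
    Diamond.v (g 0) ≡ x → Diamond.v' (g t) ≡ y →
    Σ (DiamondPath P G) λ p → Connects p x y
  diamondPath P G g t isDiamond linked start end =
    record { t      = t
           ; dia    = g ∘ toℕ
           ; isDia  = λ i → isDiamond (toℕ i) (s≤s⁻¹ (toℕ<n i))
           ; linked = λ i → trans (linked (toℕ i) (toℕ<n i)) (cong (Diamond.v' ∘ g) (sym (toℕ-inject₁ i))) } ,
    start , trans (cong (Diamond.v' ∘ g) (toℕ-fromℕ t)) end

module Chain (m : ℕ) where

  open Counting
  open Diamonds
  open import Data.Nat using (ℕ; zero; suc; _+_; _∸_; _≤_; _<_; s≤s; s≤s⁻¹; _<?_)
  open import Data.Nat.Properties
  open import Data.Fin using (Fin; zero; suc; toℕ; fromℕ<)
  open import Data.Fin.Properties using (toℕ-fromℕ<; toℕ-injective; toℕ<n)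
  open import Data.Product using (Σ; _,_)
  open import Relation.Nullary using (yes; no; contradiction)
  open import Relation.Binary.PropositionalEquality
  open import Relation.Binary using (tri<; tri≈; tri>)

  -- Clamped to 0 outside the vertex set; only used for k ≤ m.
  vertex : ℕ → Fin (suc m)
  vertex k with k <? suc m
  ... | yes k<n = fromℕ< k<n
  ... | no  _   = zero

  toℕ-vertex : ∀ {k} → k < suc m → toℕ (vertex k) ≡ k
  toℕ-vertex {k} k<n with k <? suc m
  ... | yes _   = toℕ-fromℕ< _
  ... | no  k≮n = contradiction k<n k≮n

  vertex-toℕ : ∀ x → vertex (toℕ x) ≡ x
  vertex-toℕ x = toℕ-injective (toℕ-vertex (toℕ<n x))

  vertex-injective : ∀ {a b} → a < suc m → b < suc m → vertex a ≡ vertex b → a ≡ b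
  vertex-injective {a} {b} a<n b<n eq = begin
    a                ≡⟨ sym (toℕ-vertex a<n) ⟩
    toℕ (vertex a)   ≡⟨ cong toℕ eq ⟩
    toℕ (vertex b)   ≡⟨ toℕ-vertex b<n ⟩
    b                ∎
    where open ≡-Reasoning

  middle-multiplicity : ∀ x → multiplicity (λ (k : Fin m) → vertex (toℕ k)) x ≤ 1
  middle-multiplicity = multiplicity-injective _ λ eq →
    toℕ-injective (vertex-injective (m<n⇒m<1+n (toℕ<n _)) (m<n⇒m<1+n (toℕ<n _)) eq)

  middle'-multiplicity : ∀ x → multiplicity (λ (k : Fin m) → vertex (suc (toℕ k))) x ≤ 1
  middle'-multiplicity = multiplicity-injective _ λ eq →
    toℕ-injective (suc-injective (vertex-injective (s≤s (toℕ<n _)) (s≤s (toℕ<n _)) eq))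

  chain : (ℕ → Fin (suc m)) → (ℕ → Fin (suc m)) → ℕ → Diamond (suc m)
  chain u w k = diamond (u k) (vertex k) (vertex (suc k)) (w k)

  module _ (P : Path3) (G : Digraph (suc m)) (u w : ℕ → Fin (suc m))
           (isDiamond : ∀ k → k < m → IsDiamondIn P G (chain u w k)) where

    ascending : ∀ x y → toℕ x < toℕ y → Σ (DiamondPath P G) λ p → Connects p x y
    ascending x y a<b = diamondPath P G (λ i → chain u w (a + i)) (b ∸ suc a)
        (λ i i≤t → isDiamond (a + i) (≤-trans (s≤s (+-monoʳ-≤ a i≤t)) (≤-trans (≤-reflexive last) b≤m)))
        (λ i _ → cong vertex (+-suc a i))
        (trans (cong vertex (+-identityʳ a)) (vertex-toℕ x))
        (trans (cong vertex last) (vertex-toℕ y))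
      where
      a = toℕ x
      b = toℕ y
      b≤m : b ≤ m
      b≤m = s≤s⁻¹ (toℕ<n y)
      last : suc (a + (b ∸ suc a)) ≡ b
      last = m+[n∸m]≡n a<b

    descending : ∀ x y → toℕ y < toℕ x → Σ (DiamondPath P G) λ p → Connects p x y
    descending x y b<a with toℕ x | toℕ<n x | vertex-toℕ x
    ... | suc c | c<m | start =
      diamondPath P G (λ i → swapMiddle (chain u w (c ∸ i))) (c ∸ b)
        (λ i _ → swapMiddle-isDiamondIn P G _ (isDiamond (c ∸ i) (≤-<-trans (m∸n≤m c i) (s≤s⁻¹ c<m))))
        (λ i i<t → cong vertex (sym (+-∸-assoc 1 (<-≤-trans i<t (m∸n≤m c b)))))
        start
        (trans (cong vertex (m∸[m∸n]≡n (s≤s⁻¹ b<a))) (vertex-toℕ y))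
      where
      b = toℕ y

    chain-PConnected : PConnected P G
    chain-PConnected x y x≢y with <-cmp (toℕ x) (toℕ y)
    ... | tri< x<y _ _ = ascending x y x<y
    ... | tri≈ _ x≡y _ = contradiction (toℕ-injective x≡y) x≢y
    ... | tri> _ _ y<x = descending x y y<x

  chain-EveryRoleAtMost : ∀ u w {Λ} → 1 ≤ Λ →
    (∀ x → multiplicity (λ (k : Fin m) → u (toℕ k)) x ≤ Λ) →
    (∀ x → multiplicity (λ (k : Fin m) → w (toℕ k)) x ≤ Λ) →
    EveryRoleAtMost Λ (λ (k : Fin m) → chain u w (toℕ k))
  chain-EveryRoleAtMost u w 1≤Λ u≤Λ w≤Λ x =
    u≤Λ x , ≤-trans (middle-multiplicity x) 1≤Λ , ≤-trans (middle'-multiplicity x) 1≤Λ , w≤Λ x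

module Neighbourhoods {n : ℕ} (D : Digraph n) where

  open Counting
  open import Data.Nat using (_+_; _≤_)
  open import Data.Bool using (true; false; _∧_; not)
  open import Data.Product using (_×_; _,_; proj₁; proj₂)
  open import Data.Sum using (inj₁; inj₂)
  open import Function using (case_of_)
  open import Relation.Binary.PropositionalEquality

  arc : Bool → Fin n → Fin n → Bool
  arc true  a b = D a b
  arc false a b = D b a

  arc-not : ∀ o a b → arc (not o) a b ≡ arc o b a
  arc-not true  a b = refl
  arc-not false a b = refl

  arc-irreflexive : Loopless D → ∀ o {a b} → arc o a b ≡ true → a ≢ b
  arc-irreflexive loopless true  {a} ab refl = case (trans (sym ab) (loopless a)) of λ ()
  arc-irreflexive loopless false {a} ab refl = case (trans (sym ab) (loopless a)) of λ ()

  arc-OArc : ∀ o {a b i j} → arc o a b ≡ true → OArc a b o i j → D i j ≡ true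
  arc-OArc true  ab (refl , refl) = ab
  arc-OArc false ab (refl , refl) = ab

  common : Bool → Fin n → Fin n → Fin n → Bool
  common o a b x = arc o x a ∧ arc o x b

  degree : Bool → Fin n → ℕ
  degree o a = count (λ x → arc o x a)

  degree-outdeg-indeg : ∀ {ℓ} (Good : ℕ → Set ℓ) → (∀ i → Good (outdeg D i) × Good (indeg D i)) →
                        ∀ o a → Good (degree o a)
  degree-outdeg-indeg Good good true  a = proj₂ (good a)
  degree-outdeg-indeg Good good false a = proj₁ (good a)

  count-common : ∀ o a b → degree o a + degree o b ≤ count (common o a b) + n
  count-common o a b = count-∧ (λ x → arc o x a) (λ x → arc o x b)

  common-diamond : Loopless D → ∀ o₁ o₂ {u v v' w} →
    common o₁ v v' u ≡ true → common (not o₂) v v' w ≡ true → v ≢ v' → u ≢ w →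
    IsDiamondIn (path3 o₁ o₂) D (diamond u v v' w)
  common-diamond loopless o₁ o₂ {u} {v} {v'} {w} uv∧uv' wv∧wv' v≢v' u≢w =
    (arc-irreflexive loopless o₁ uv , arc-irreflexive loopless o₁ uv' , u≢w , v≢v' ,
     arc-irreflexive loopless o₂ vw , arc-irreflexive loopless o₂ v'w) ,
    λ where _ _ (inj₁ a)               → arc-OArc o₁ uv a
            _ _ (inj₂ (inj₁ a))        → arc-OArc o₁ uv' a
            _ _ (inj₂ (inj₂ (inj₁ a))) → arc-OArc o₂ vw a
            _ _ (inj₂ (inj₂ (inj₂ a))) → arc-OArc o₂ v'w a
    where
    uv  = proj₁ (∧-true uv∧uv')
    uv' = proj₂ (∧-true uv∧uv')
    vw  = trans (sym (arc-not o₂ w v)) (proj₁ (∧-true wv∧wv'))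
    v'w = trans (sym (arc-not o₂ w v')) (proj₂ (∧-true wv∧wv'))

module Construction {m : ℕ} (D : Digraph (suc m)) (loopless : Loopless D) (o₁ o₂ : Bool) (Λ : ℕ)
  (1≤Λ : 1 ℕ.≤ Λ)
  (wide : ∀ h → Λ ℕ.* h ℕ.< m → ∀ o a b → h ℕ.+ 2 ℕ.≤ count (Neighbourhoods.common D o a b)) where

  open Counting
  open Diamonds
  open Neighbourhoods D
  open Chain m
  open import Data.Nat using (_+_; _*_; _≤_; _<_; s≤s)
  open import Data.Nat.Properties hiding (_≟_)
  open import Data.Bool using (_∧_; not)
  open import Data.Fin using (toℕ; fromℕ<)
  open import Data.Fin.Properties using (_≟_; toℕ<n; toℕ-fromℕ<)
  open import Data.Product using (_×_; _,_; proj₁; proj₂)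
  open import Function using (_∘_)
  open import Relation.Nullary using (does)
  open import Relation.Binary.PropositionalEquality

  P : Path3
  P = path3 o₁ o₂

  module Prefix = Greedy Λ (λ k → common o₁ (vertex k) (vertex (suc k)))

  prefix : ℕ → Fin (suc m)
  prefix = Prefix.choice

  module Suffix = Greedy Λ (λ k x → common (not o₂) (vertex k) (vertex (suc k)) x ∧ not (does (x ≟ prefix k)))

  suffix : ℕ → Fin (suc m)
  suffix = Suffix.choice

  prefix-plenty : ∀ k → k < m → Prefix.Plenty k
  prefix-plenty k k<m h Λh≤k = ≤-trans (+-monoʳ-≤ h (n≤1+n 1)) (wide h (≤-<-trans Λh≤k k<m) o₁ _ _)

  suffix-plenty : ∀ k → k < m → Suffix.Plenty k
  suffix-plenty k k<m h Λh≤k = +-cancelʳ-≤ 1 (h + 1) _ (begin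
    h + 1 + 1  ≡⟨ +-assoc h 1 1 ⟩
    h + 2      ≤⟨ wide h (≤-<-trans Λh≤k k<m) (not o₂) _ _ ⟩
    count candidates ≤⟨ count-split candidates (λ x → does (x ≟ prefix k)) ⟩
    count (λ x → candidates x ∧ not (does (x ≟ prefix k))) + count (λ x → does (x ≟ prefix k))
      ≤⟨ +-monoʳ-≤ _ (multiplicity-injective (λ x → x) (λ eq → eq) (prefix k)) ⟩
    count (λ x → candidates x ∧ not (does (x ≟ prefix k))) + 1 ∎)
    where
    open ≤-Reasoning
    candidates = common (not o₂) (vertex k) (vertex (suc k))

  diamondAt : ℕ → Diamond (suc m)
  diamondAt = chain prefix suffix

  diamondAt-isDiamondIn : ∀ k → k < m → IsDiamondIn P D (diamondAt k)
  diamondAt-isDiamondIn k k<m =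
    common-diamond loopless o₁ o₂ (Prefix.choice-candidate m prefix-plenty k k<m) (proj₁ suffix-ok)
      (λ eq → 1+n≢n (sym (vertex-injective (m<n⇒m<1+n k<m) (s≤s k<m) eq)))
      (λ eq → not-does-sound (suffix k ≟ prefix k) (proj₂ suffix-ok) (sym eq))
    where
    suffix-ok = ∧-true (Suffix.choice-candidate m suffix-plenty k k<m)

  diamonds : Fin m → Diamond (suc m)
  diamonds k = diamondAt (toℕ k)

  H : Digraph (suc m)
  H = ⋃ P diamonds

  H-⊆ᴰ : H ⊆ᴰ D
  H-⊆ᴰ = ⋃-⊆ᴰ P diamonds D λ k → diamondAt-isDiamondIn (toℕ k) (toℕ<n k)

  H-PConnected : PConnected P H
  H-PConnected = chain-PConnected P H prefix suffix λ k k<m →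
    subst (IsDiamondIn P H ∘ diamondAt) (toℕ-fromℕ< k<m)
      (⋃-contains P diamonds (fromℕ< k<m) (proj₁ (diamondAt-isDiamondIn _ (toℕ<n (fromℕ< k<m)))))

  H-roles : EveryRoleAtMost Λ diamonds
  H-roles = chain-EveryRoleAtMost prefix suffix 1≤Λ
    (Prefix.choice-multiplicity m prefix-plenty) (Suffix.choice-multiplicity m suffix-plenty)

  H-degrees : ∀ x → (outdeg H x ≤ Λ + (Λ + (Λ + Λ))) × (indeg H x ≤ Λ + (Λ + (Λ + Λ)))
  H-degrees x = ⋃-outdeg o₁ o₂ diamonds Λ H-roles x , ⋃-indeg o₁ o₂ diamonds Λ H-roles x

module Arithmetic where

  open import Data.Nat using (suc; _+_; _*_; _≤_; _<_; NonZero; >-nonZero)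
  open import Data.Nat.Properties
  open import Data.Nat.DivMod using (_/_; _%_; m/n*n≤m; m≡m%n+[m/n]*n; m%n<n; m≥n⇒m/n>0)
  open import Data.Nat.Tactic.RingSolver using (solve-∀)
  open import Data.Product using (_×_; _,_)
  open import Relation.Binary.PropositionalEquality

  -- d ≥ (1/2 + p/q) n, with the denominators cleared
  AboveHalfPlus : ℕ → ℕ → ℕ → ℕ → Set
  AboveHalfPlus p q n d = (q + 2 * p) * n ≤ 2 * q * d

  2p≤q : ∀ p q n d .{{_ : NonZero n}} → AboveHalfPlus p q n d → d ≤ n → 2 * p ≤ q
  2p≤q p q n d dense d≤n = +-cancelˡ-≤ q _ _ (*-cancelʳ-≤ _ _ n (begin
    (q + 2 * p) * n   ≤⟨ dense ⟩
    2 * q * d         ≤⟨ *-monoʳ-≤ (2 * q) d≤n ⟩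
    2 * q * n         ≡⟨ double q n ⟩
    (q + q) * n       ∎))
    where
    open ≤-Reasoning
    double : ∀ q n → 2 * q * n ≡ (q + q) * n
    double = solve-∀

  common-lower-bound : ∀ p q n da db c → AboveHalfPlus p q n da → AboveHalfPlus p q n db →
                       da + db ≤ c + n → 2 * p * n ≤ q * c
  common-lower-bound p q n da db c dense-a dense-b da+db≤c+n =
    +-cancelˡ-≤ (q * n) _ _ (*-cancelˡ-≤ 2 (begin
      2 * (q * n + 2 * p * n)       ≡⟨ expand-left p q n ⟩
      (q + 2 * p) * n + (q + 2 * p) * n ≤⟨ +-mono-≤ dense-a dense-b ⟩
      2 * q * da + 2 * q * db       ≡⟨ sym (*-distribˡ-+ (2 * q) da db) ⟩
      2 * q * (da + db)             ≤⟨ *-monoʳ-≤ (2 * q) da+db≤c+n ⟩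
      2 * q * (c + n)               ≡⟨ expand-right q n c ⟩
      2 * (q * n + q * c)           ∎))
    where
    open ≤-Reasoning
    expand-left : ∀ p q n → 2 * (q * n + 2 * p * n) ≡ (q + 2 * p) * n + (q + 2 * p) * n
    expand-left = solve-∀
    expand-right : ∀ q n c → 2 * q * (c + n) ≡ 2 * (q * n + q * c)
    expand-right = solve-∀

  saturated+2≤common : ∀ p q Λ m h c → 1 ≤ Λ → 1 ≤ q → suc q ≤ 2 * Λ * p → 2 * q * Λ ≤ m →
                       Λ * h < m → 2 * p * suc m ≤ q * c → h + 2 ≤ c
  saturated+2≤common p q Λ m h c 1≤Λ 1≤q q<2Λp 2qΛ≤m Λh<m 2pn≤qc =
    *-cancelˡ-≤ Λ {{>-nonZero 1≤Λ}} (*-cancelˡ-≤ q {{>-nonZero 1≤q}} (begin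
      q * (Λ * (h + 2))     ≡⟨ expand q Λ h ⟩
      q * (Λ * h) + 2 * q * Λ ≤⟨ +-mono-≤ (*-monoʳ-≤ q (<⇒≤ Λh<m)) 2qΛ≤m ⟩
      q * m + m             ≡⟨ +-comm (q * m) m ⟩
      suc q * m             ≤⟨ *-monoʳ-≤ (suc q) (n≤1+n m) ⟩
      suc q * suc m         ≤⟨ *-monoˡ-≤ (suc m) q<2Λp ⟩
      2 * Λ * p * suc m     ≡⟨ regroup Λ p (suc m) ⟩
      Λ * (2 * p * suc m)   ≤⟨ *-monoʳ-≤ Λ 2pn≤qc ⟩
      Λ * (q * c)           ≡⟨ swap Λ q c ⟩
      q * (Λ * c)           ∎))
    where
    open ≤-Reasoning
    expand : ∀ q Λ h → q * (Λ * (h + 2)) ≡ q * (Λ * h) + 2 * q * Λ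
    expand = solve-∀
    regroup : ∀ Λ p n → 2 * Λ * p * n ≡ Λ * (2 * p * n)
    regroup = solve-∀
    swap : ∀ Λ q c → Λ * (q * c) ≡ q * (Λ * c)
    swap = solve-∀

  quotient-bounds : ∀ p q .{{_ : NonZero p}} → p ≤ q →
                    (1 ≤ q / p) × (q / p * p ≤ q) × (suc q ≤ 2 * (q / p) * p)
  quotient-bounds p q p≤q = 1≤Λ , m/n*n≤m q p , (begin-strict
    q                       ≡⟨ m≡m%n+[m/n]*n q p ⟩
    q % p + q / p * p       <⟨ +-monoˡ-< (q / p * p) (m%n<n q p) ⟩
    p + q / p * p           ≤⟨ +-monoˡ-≤ (q / p * p) (subst (_≤ q / p * p) (*-identityˡ p) (*-monoˡ-≤ p 1≤Λ)) ⟩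
    q / p * p + q / p * p   ≡⟨ double (q / p) p ⟩
    2 * (q / p) * p         ∎)
    where
    open ≤-Reasoning
    1≤Λ : 1 ≤ q / p
    1≤Λ = m≥n⇒m/n>0 p≤q
    double : ∀ Λ p → Λ * p + Λ * p ≡ 2 * Λ * p
    double = solve-∀

  four-roles-bound : ∀ p q Λ d → d ≤ Λ + (Λ + (Λ + Λ)) → Λ * p ≤ q → d * p ≤ 4 * q
  four-roles-bound p q Λ d d≤4Λ Λp≤q = begin
    d * p                     ≤⟨ *-monoˡ-≤ p d≤4Λ ⟩
    (Λ + (Λ + (Λ + Λ))) * p   ≡⟨ quadruple Λ p ⟩
    4 * (Λ * p)               ≤⟨ *-monoʳ-≤ 4 Λp≤q ⟩
    4 * q                     ∎
    where
    open ≤-Reasoning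
    quadruple : ∀ Λ p → (Λ + (Λ + (Λ + Λ))) * p ≡ 4 * (Λ * p)
    quadruple = solve-∀

module Density (p q : ℕ) {m : ℕ} (D : Digraph (suc m))
  (dense : ∀ i → Arithmetic.AboveHalfPlus (suc p) (suc q) (suc m) (outdeg D i)
               × Arithmetic.AboveHalfPlus (suc p) (suc q) (suc m) (indeg D i)) where

  open Arithmetic
  open Counting using (count≤n)
  open Neighbourhoods D
  open import Data.Nat using (_+_; _*_; _/_; _≤_; _<_; z≤n; s≤s)
  open import Data.Nat.Properties using (≤-trans; m≤m+n)
  open import Data.Fin using (zero)
  open import Data.Product using (_×_; proj₁; proj₂)

  Λ : ℕ
  Λ = suc q / suc p

  p≤q : suc p ≤ suc q
  p≤q = ≤-trans (m≤m+n (suc p) (suc p + 0))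
          (2p≤q (suc p) (suc q) (suc m) (outdeg D zero) (proj₁ (dense zero)) (count≤n (D zero)))

  1≤Λ : 1 ≤ Λ
  1≤Λ = proj₁ (quotient-bounds (suc p) (suc q) p≤q)

  Λp≤q : Λ * suc p ≤ suc q
  Λp≤q = proj₁ (proj₂ (quotient-bounds (suc p) (suc q) p≤q))

  q<2Λp : suc (suc q) ≤ 2 * Λ * suc p
  q<2Λp = proj₂ (proj₂ (quotient-bounds (suc p) (suc q) p≤q))

  wide : 2 * suc q * Λ ≤ m → ∀ h → Λ * h < m → ∀ o a b → h + 2 ≤ count (common o a b)
  wide 2qΛ≤m h Λh<m o a b =
    saturated+2≤common (suc p) (suc q) Λ m h _ 1≤Λ (s≤s z≤n) q<2Λp 2qΛ≤m Λh<m
      (common-lower-bound (suc p) (suc q) (suc m) _ _ _ (dense-degree o a) (dense-degree o b) (count-common o a b))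
    where
    dense-degree = degree-outdeg-indeg (AboveHalfPlus (suc p) (suc q) (suc m)) dense

  scaled-degree : ∀ d → d ≤ Λ + (Λ + (Λ + Λ)) → d * suc p ≤ 4 * suc q
  scaled-degree d d≤4Λ = four-roles-bound (suc p) (suc q) Λ d d≤4Λ Λp≤q

module RationalBounds where

  open Arithmetic using (AboveHalfPlus)
  import Data.Nat.Properties as ℕ
  open import Data.Nat.Coprimality using (Coprime)
  open import Data.Nat.Divisibility using (∣1⇒≡1)
  open import Data.Nat.Tactic.RingSolver using (solve-∀)
  open import Data.Integer as ℤ using (+_; +[1+_])
  import Data.Integer.Properties as ℤ
  open import Data.Rational using (mkℚ; ½; _+_; _*_; _/_; _≤_)
  import Data.Rational.Properties as ℚ
  open import Data.Rational.Unnormalised using (*≤*)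
  import Data.Rational.Unnormalised.Properties as ℚᵘ
  open import Data.Product using (proj₂)
  open import Relation.Binary.PropositionalEquality

  coprime-1 : ∀ n → Coprime n 1
  coprime-1 n common = ∣1⇒≡1 (proj₂ common)

  +n/1≡mkℚ : ∀ n → + n / 1 ≡ mkℚ (+ n) 0 (coprime-1 n)
  +n/1≡mkℚ n = ℚ.normalize-coprime (coprime-1 n)

  half+α-bound : ∀ p q .(c : Coprime (suc p) (suc q)) n d →
    (½ + mkℚ +[1+ p ] q c) * (+ n / 1) ≤ + d / 1 → AboveHalfPlus (suc p) (suc q) n d
  half+α-bound p q c n d h rewrite +n/1≡mkℚ n | +n/1≡mkℚ d
    with ℚᵘ.≤-respˡ-≃ (ℚᵘ.≃-trans (ℚ.toℚᵘ-homo-* (½ + mkℚ +[1+ p ] q c) (mkℚ (+ n) 0 (coprime-1 n)))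
                                  (ℚᵘ.*-congʳ (ℚ.toℚᵘ-homo-+ ½ (mkℚ +[1+ p ] q c))))
                      (ℚ.toℚᵘ-mono-≤ h)
  ... | *≤* h′ = subst₂ ℕ._≤_ (clean-left (suc p) (suc q) n) (clean-right (suc q) d)
                   (ℤ.drop‿+≤+ (subst₂ ℤ._≤_ (sym pos-left) right h′))
    where
    P = suc p
    Q = suc q
    -- the unnormalised numerator of (½ + P/Q) * n, written in ℕ
    pos-left : + ((1 ℕ.* Q ℕ.+ P ℕ.* 2) ℕ.* n ℕ.* 1) ≡ ((+ 1 ℤ.* + Q ℤ.+ + P ℤ.* + 2) ℤ.* + n) ℤ.* + 1
    pos-left = begin
      + ((1 ℕ.* Q ℕ.+ P ℕ.* 2) ℕ.* n ℕ.* 1)           ≡⟨ ℤ.pos-* ((1 ℕ.* Q ℕ.+ P ℕ.* 2) ℕ.* n) 1 ⟩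
      + ((1 ℕ.* Q ℕ.+ P ℕ.* 2) ℕ.* n) ℤ.* + 1         ≡⟨ cong (ℤ._* + 1) (ℤ.pos-* (1 ℕ.* Q ℕ.+ P ℕ.* 2) n) ⟩
      (+ (1 ℕ.* Q ℕ.+ P ℕ.* 2) ℤ.* + n) ℤ.* + 1       ≡⟨ cong (λ z → (z ℤ.* + n) ℤ.* + 1) (ℤ.pos-+ (1 ℕ.* Q) (P ℕ.* 2)) ⟩
      ((+ (1 ℕ.* Q) ℤ.+ + (P ℕ.* 2)) ℤ.* + n) ℤ.* + 1 ≡⟨ cong (λ z → (z ℤ.* + n) ℤ.* + 1) (cong₂ ℤ._+_ (ℤ.pos-* 1 Q) (ℤ.pos-* P 2)) ⟩
      ((+ 1 ℤ.* + Q ℤ.+ + P ℤ.* + 2) ℤ.* + n) ℤ.* + 1 ∎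
      where open ≡-Reasoning
    right : + d ℤ.* + (2 ℕ.* Q ℕ.* 1) ≡ + (d ℕ.* (2 ℕ.* Q ℕ.* 1))
    right = sym (ℤ.pos-* d (2 ℕ.* Q ℕ.* 1))
    clean-left : ∀ p q n → (1 ℕ.* q ℕ.+ p ℕ.* 2) ℕ.* n ℕ.* 1 ≡ (q ℕ.+ 2 ℕ.* p) ℕ.* n
    clean-left = solve-∀
    clean-right : ∀ q d → d ℕ.* (2 ℕ.* q ℕ.* 1) ≡ 2 ℕ.* q ℕ.* d
    clean-right = solve-∀

  times-α-bound : ∀ p q .(c : Coprime (suc p) (suc q)) k →
    k ℕ.* suc p ℕ.≤ 4 ℕ.* suc q → (+ k / 1) * mkℚ +[1+ p ] q c ≤ + 4 / 1
  times-α-bound p q c k h rewrite +n/1≡mkℚ k =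
    ℚ.toℚᵘ-cancel-≤ (ℚᵘ.≤-respˡ-≃ (ℚᵘ.≃-sym (ℚ.toℚᵘ-homo-* (mkℚ (+ k) 0 (coprime-1 k)) (mkℚ +[1+ p ] q c)))
                                 (*≤* (subst₂ ℤ._≤_ left right (ℤ.+≤+ h))))
    where
    left : + (k ℕ.* suc p) ≡ (+ k ℤ.* + suc p) ℤ.* + 1
    left = trans (sym (ℤ.*-identityʳ (+ (k ℕ.* suc p)))) (cong (ℤ._* + 1) (ℤ.pos-* k (suc p)))
    right : + (4 ℕ.* suc q) ≡ + 4 ℤ.* + (1 ℕ.* suc q)
    right = trans (cong (λ z → + (4 ℕ.* z)) (sym (ℕ.*-identityˡ (suc q)))) (ℤ.pos-* 4 (1 ℕ.* suc q))

open import Data.Nat using (ℕ; _≥_; _∸_)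
open import Data.Integer using (+_)
open import Data.Rational using (ℚ; 0ℚ; ½; _+_; _*_; _/_; _≤_; _<_)
open import Data.Fin using (Fin)
open import Data.Product using (Σ; ∃; _×_)
open import Relation.Binary.PropositionalEquality using (_≡_)

open import Data.Nat using (zero; s≤s)
open import Data.Integer using (+[1+_]; -[1+_]; +<+)
open import Data.Rational using (mkℚ; *<*)
open import Data.Fin using (toℕ)
open import Data.Fin.Properties using (toℕ<n)
open import Data.Product using (_,_; proj₁; proj₂)

lemma2p18 : (α : ℚ) → 0ℚ < α →
    ∃ λ (n₀ : ℕ) → (n : ℕ) → n ≥ n₀ →
    (D : Digraph n) → Loopless D →
    ((i : Fin n) → ((½ + α) * (+ n / 1) ≤ + (outdeg D i) / 1)
                 × ((½ + α) * (+ n / 1) ≤ + (indeg D i) / 1)) →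
    (P : Path3) →
    Σ (Digraph n) λ H →
      (H ⊆ᴰ D)
      × PConnected P H
      × (Σ (Fin (n ∸ 1) → Diamond n) λ ds →
           ((k : Fin (n ∸ 1)) → IsDiamondIn P D (ds k)) × IsUnionOf P H ds)
      × ((i : Fin n) → ((+ (outdeg H i) / 1) * α ≤ + 4 / 1)
                     × ((+ (indeg H i) / 1) * α ≤ + 4 / 1))
lemma2p18 (mkℚ -[1+ _ ] _ _) (*<* ())
lemma2p18 (mkℚ (+ zero) _ _) (*<* (+<+ ()))
lemma2p18 (mkℚ +[1+ p ] q c) _ = suc (2 ℕ.* suc q ℕ.* (suc q ℕ./ suc p)) , λ where
  (suc m) (s≤s 2qΛ≤m) D loopless degrees (path3 o₁ o₂) →
    let dense i = RationalBounds.half+α-bound p q c _ _ (proj₁ (degrees i)) ,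
                  RationalBounds.half+α-bound p q c _ _ (proj₂ (degrees i))
        open Density p q D dense
        open Construction D loopless o₁ o₂ Λ 1≤Λ (wide 2qΛ≤m)
    in H , H-⊆ᴰ , H-PConnected ,
       (diamonds , (λ k → diamondAt-isDiamondIn (toℕ k) (toℕ<n k)) , Diamonds.⋃-isUnionOf P diamonds) ,
       λ x → RationalBounds.times-α-bound p q c (outdeg H x) (scaled-degree _ (proj₁ (H-degrees x))) ,
             RationalBounds.times-α-bound p q c (indeg H x) (scaled-degree _ (proj₂ (H-degrees x)))
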